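{- Let $n,k$ be integers with $n\ge2$ and $2\le k\le n-1$. Then $1\le a_k^n\le u(n,k)$, where \[ u(n,k)=\begin{cases} n-k(k-1)-1 & \text{if } n-k(k-1)-1\ge\lceil (n-k)/k\rceil,\\ \lceil (n-k)/k\rceil & \text{otherwise.}\end{cases} \]
   Context: A matrix is NZ if every row and column has a positive entry; the weight of a nonnegative vector is its number of positive entries; $A_{*i}$ is the $i$-th column of $A$ and $\mathrm{supp}(v)=\{i:v_i>0\}$. For $2\le k\le n-1$, $\mathcal{S}_n^k$ is the set of $n\times n$ nonnegative NZ matrices all of whose rows and columns have weight at most $k$ and having at least one column of weight exactly $k$; for $A\in\mathcal{S}_n^k$, $\mathcal{C}_A$ is the set of indices of columns of weight $k$, $a_k^n(A)=\min_{c\in\mathcal{C}_A}|\{i:\mathrm{supp}(A_{*i})\not\subseteq\mathrm{supp}(A_{*c})\}|$, and $a_k^n=\min_{A\in\mathcal{S}_n^k}a_k^n(A)$.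
   Formalization: The matrices in $\mathcal{S}_n^k$ have entries in the rationals. -}

module Defs where

open import Data.Nat as ℕ using (ℕ; _∸_; _/_; suc)
open import Data.Integer as ℤ using (ℤ; +_)
open import Data.Rational as ℚ using (ℚ; 0ℚ)
open import Data.Rational.Properties using (_<?_)
open import Data.Fin using (Fin)
open import Data.Fin.Subset using (Subset; _⊆_; ∣_∣)
open import Data.Fin.Subset.Properties using (_⊆?_)
open import Data.Vec using (tabulate)
open import Data.Bool using (not)
open import Data.Product using (Σ; ∃; _×_)
open import Relation.Nullary using (does; yes; no)
open import Data.Nat using (zero)
open import Relation.Binary.PropositionalEquality using (_≡_)

-- n × n matrices with rational entries (no reals in agda-stdlib)
Matrix : ℕ → Set
Matrix n = Fin n → Fin n → ℚ

Vector : ℕ → Set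
Vector n = Fin n → ℚ

supp : ∀ {n} → Vector n → Subset n
supp v = tabulate (λ i → does (0ℚ <? v i))

weight : ∀ {n} → Vector n → ℕ
weight v = ∣ supp v ∣

row : ∀ {n} → Matrix n → Fin n → Vector n
row A i = λ j → A i j

col : ∀ {n} → Matrix n → Fin n → Vector n
col A i = λ r → A r i

Nonnegative : ∀ {n} → Matrix n → Set
Nonnegative A = ∀ i j → 0ℚ ℚ.≤ A i j

NZ : ∀ {n} → Matrix n → Set
NZ {n} A = (∀ i → ∃ λ j → 0ℚ ℚ.< A i j) × (∀ j → ∃ λ i → 0ℚ ℚ.< A i j)

InS : (n k : ℕ) → Matrix n → Set
InS n k A = Nonnegative A × NZ A
          × (∀ i → weight (row A i) ℕ.≤ k)
          × (∀ j → weight (col A j) ℕ.≤ k)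
          × (∃ λ c → weight (col A c) ≡ k)

InC : (n k : ℕ) → Matrix n → Fin n → Set
InC n k A c = weight (col A c) ≡ k

notContained : ∀ {n} → Matrix n → Fin n → ℕ
notContained A c = ∣ tabulate (λ i → not (does (supp (col A i) ⊆? supp (col A c)))) ∣

-- ⌈ m / k ⌉ for k ≥ 1 (k = 0 never occurs in the statement; value 0 there)
ceilDiv : ℕ → ℕ → ℕ
ceilDiv m zero    = 0
ceilDiv m (suc k) = (m ℕ.+ k) / suc k

-- u(n,k) as in the paper, as an integer (n - k(k-1) - 1 may be negative)
u : ℕ → ℕ → ℤ
u n k with ℤ.+ (ceilDiv (n ∸ k) k) ℤ.≤? t
  where t = (+ n) ℤ.- (+ (k ℕ.* (k ∸ 1)) ) ℤ.- (+ 1)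
... | yes _ = (+ n) ℤ.- (+ (k ℕ.* (k ∸ 1))) ℤ.- (+ 1)
... | no  _ = + (ceilDiv (n ∸ k) k)

-- A column c of weight k < n misses some row r, and any column meeting r is not contained in c,
-- so a ≥ 1. For the upper bound put q = ⌈(n − k)/k⌉, m = max(q, n − k(k − 1) − 1), which is u(n,k),
-- and p = n − 1 − m, and take the 0/1 matrix in which column 0 covers rows 0,…,k−1, column 1 + j
-- (j < p) has its single entry in row j mod k, and row k + i (i < n − k) has its single entry in
-- column 1 + p + (i mod m). Rows r < k then have weight 1 + ⌈p/k⌉ ≤ k since p ≤ k(k − 1); each of
-- the last m columns has weight at most ⌈(n − k)/m⌉ ≤ k since m ≥ q, and at least 1 since
-- m ≤ n − k. Columns 0,…,p lie inside column 0, so at most m columns are not contained in it.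
module Submission where

open import Defs

open import Data.Bool.Base using (Bool; true; false; T; not; _∧_; if_then_else_)
open import Data.Bool.Properties using (T-≡; T-not-≡; T-∧)
open import Data.Empty using (⊥-elim)
open import Data.Fin.Base as Fin using (Fin; toℕ)
open import Data.Fin.Properties using (toℕ<n)
open import Data.Fin.Subset using (Subset; _∈_; _∉_; _⊆_; ∣_∣; Nonempty)
open import Data.Fin.Subset.Properties
  using (_⊆?_; nonempty?; Empty-unique; ∣⊥∣≡0; ∣⁅x⁆∣≡1; x∈⁅y⁆⇒x≡y; p⊆q⇒∣p∣≤∣q∣; ∣∁p∣≡n∸∣p∣; x∈∁p⇒x∉p)
open import Data.Integer.Base as ℤ using (+_; _⊖_)
import Data.Integer.Properties as ℤ
open import Data.Nat.Base
open import Data.Nat.DivMod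
  using (_%_; m%n<n; m<n⇒m%n≡m; %-remove-+ˡ; m≡m%n+[m/n]*n; m<n*o⇒m/o<n; m≥n⇒m/n>0)
open import Data.Nat.Divisibility using (∣-refl)
open import Data.Nat.Properties
open import Data.Product using (Σ; ∃; _×_; _,_; proj₁; proj₂)
open import Data.Rational.Base as ℚ using (0ℚ; 1ℚ)
import Data.Rational.Properties as ℚ
open import Data.Vec.Base using (tabulate)
open import Data.Vec.Properties using (lookup∘tabulate; tabulate-cong; []=⇒lookup; lookup⇒[]=)
open import Function.Base using (_∘_)
open import Function.Bundles using (Equivalence)
open import Relation.Binary.PropositionalEquality
open import Relation.Nullary using (¬_; Dec; yes; no; does; contradiction)
open import Relation.Nullary.Decidable using (dec-true; dec-false)

open Equivalence using (to; from)

¬T⇒≡false : ∀ {b} → ¬ T b → b ≡ false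
¬T⇒≡false {false} _  = refl
¬T⇒≡false {true}  ¬b = ⊥-elim (¬b _)

count : ℕ → (ℕ → Bool) → ℕ
count zero    f = 0
count (suc n) f = (if f 0 then 1 else 0) + count n (λ i → f (suc i))

count-suc-true : ∀ n f → T (f 0) → count (suc n) f ≡ suc (count n (f ∘ suc))
count-suc-true n f f0 rewrite to T-≡ f0 = refl

count-suc-false : ∀ n f → ¬ T (f 0) → count (suc n) f ≡ count n (f ∘ suc)
count-suc-false n f ¬f0 with f 0
... | false = refl
... | true  = ⊥-elim (¬f0 _)

count-cong : ∀ n {f g} → (∀ i → i < n → f i ≡ g i) → count n f ≡ count n g
count-cong zero    _  = refl
count-cong (suc n) eq =
  cong₂ (λ b c → (if b then 1 else 0) + c) (eq 0 z<s) (count-cong n (λ i i<n → eq (suc i) (s<s i<n)))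

count-+ : ∀ a b f → count (a + b) f ≡ count a f + count b (λ i → f (a + i))
count-+ zero    b f = refl
count-+ (suc a) b f = trans (cong (λ c → (if f 0 then 1 else 0) + c) (count-+ a b (λ i → f (suc i))))
                            (sym (+-assoc (if f 0 then 1 else 0) _ _))

count-split : ∀ {a n} f → a ≤ n → count n f ≡ count a f + count (n ∸ a) (λ i → f (a + i))
count-split {a} {n} f a≤n =
  subst (λ x → count x f ≡ count a f + count (n ∸ a) (λ i → f (a + i))) (m+[n∸m]≡n a≤n)
        (count-+ a (n ∸ a) f)

count-mono-≤ : ∀ {m n} f → m ≤ n → count m f ≤ count n f
count-mono-≤ f m≤n = subst (_ ≤_) (sym (count-split f m≤n)) (m≤m+n _ _)

count-all : ∀ n {f} → (∀ i → i < n → T (f i)) → count n f ≡ n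
count-all zero    _ = refl
count-all (suc n) {f} all with f 0 | all 0 z<s
... | true | _ = cong suc (count-all n (λ i i<n → all (suc i) (s<s i<n)))

count-none : ∀ n {f} → (∀ i → i < n → ¬ T (f i)) → count n f ≡ 0
count-none zero    _ = refl
count-none (suc n) {f} none with f 0 | none 0 z<s
... | false | _   = count-none n (λ i i<n → none (suc i) (s<s i<n))
... | true  | ¬f0 = ⊥-elim (¬f0 _)

count>0 : ∀ {n f c} → c < n → T (f c) → 0 < count n f
count>0 {suc n} {f} {zero}  _ fc rewrite to T-≡ fc = s≤s z≤n
count>0 {suc n} {f} {suc c} (s<s c<n) fc = ≤-trans (count>0 {f = λ i → f (suc i)} c<n fc) (m≤n+m _ _)

count-≤1 : ∀ n {f} c → (∀ i → i < n → T (f i) → i ≡ c) → count n f ≤ 1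
count-≤1 zero    c _ = z≤n
count-≤1 (suc n) {f} c only with f 0 in f0
... | false = count-≤1 n (pred c) (λ i i<n fi → cong pred (only (suc i) (s<s i<n) fi))
... | true  = ≤-reflexive (cong suc (count-none n λ i i<n fi →
                0≢1+n (trans (only 0 z<s (subst T (sym f0) _)) (sym (only (suc i) (s<s i<n) fi)))))

count-≡ᵇ : ∀ {n c} → c < n → count n (λ i → i ≡ᵇ c) ≡ 1
count-≡ᵇ {n} {c} c<n = ≤-antisym (count-≤1 n c (λ i _ → ≡ᵇ⇒≡ i c)) (count>0 c<n (≡⇒≡ᵇ c c refl))

count-%-block : ∀ d .{{_ : NonZero d}} c → count d (λ i → c ≡ᵇ i % d) ≤ 1
count-%-block d c = count-≤1 d c (λ i i<d hit → sym (trans (≡ᵇ⇒≡ c _ hit) (m<n⇒m%n≡m i<d)))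

count-%-fiber : ∀ {N} e d .{{_ : NonZero d}} c → N ≤ e * d → count N (λ i → c ≡ᵇ i % d) ≤ e
count-%-fiber {N} e d c N≤ed = ≤-trans (count-mono-≤ _ N≤ed) (blocks e)
  where
  blocks : ∀ e → count (e * d) (λ i → c ≡ᵇ i % d) ≤ e
  blocks zero    = z≤n
  blocks (suc e) = begin
    count (d + e * d) fiber
      ≡⟨ count-+ d (e * d) fiber ⟩
    count d fiber + count (e * d) (λ i → fiber (d + i))
      ≡⟨ cong (λ c → count d fiber + c) (count-cong (e * d) shift) ⟩
    count d fiber + count (e * d) fiber
      ≤⟨ +-mono-≤ (count-%-block d c) (blocks e) ⟩
    suc e
      ∎
    where
    open ≤-Reasoning
    fiber = λ i → c ≡ᵇ i % d
    shift : ∀ i → i < e * d → fiber (d + i) ≡ fiber i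
    shift i _ = cong (c ≡ᵇ_) (%-remove-+ˡ i ∣-refl)

count-<ᵇ : ∀ {k n} → k ≤ n → count n (_<ᵇ k) ≡ k
count-<ᵇ {k} {n} k≤n = begin
  count n (_<ᵇ k)
    ≡⟨ count-split (_<ᵇ k) k≤n ⟩
  count k (_<ᵇ k) + count (n ∸ k) (λ i → k + i <ᵇ k)
    ≡⟨ cong₂ _+_ (count-all k (λ _ → <⇒<ᵇ)) (count-none (n ∸ k) (λ i _ → m+n≮m k i ∘ <ᵇ⇒< _ _)) ⟩
  k + 0
    ≡⟨ +-identityʳ k ⟩
  k
    ∎
  where open ≡-Reasoning

count-≤ᵇ : ∀ {a n} → a ≤ n → count n (a ≤ᵇ_) ≡ n ∸ a
count-≤ᵇ {a} {n} a≤n = begin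
  count n (a ≤ᵇ_)
    ≡⟨ count-split (a ≤ᵇ_) a≤n ⟩
  count a (a ≤ᵇ_) + count (n ∸ a) (λ i → a ≤ᵇ a + i)
    ≡⟨ cong₂ _+_ (count-none a (λ i i<a → <⇒≱ i<a ∘ ≤ᵇ⇒≤ a i))
                 (count-all (n ∸ a) (λ i _ → ≤⇒≤ᵇ (m≤m+n a i))) ⟩
  n ∸ a
    ∎
  where open ≡-Reasoning

module _ {n : ℕ} {f : Fin n → Bool} {x : Fin n} where

  ∈-tabulate⁺ : T (f x) → x ∈ tabulate f
  ∈-tabulate⁺ fx = lookup⇒[]= x _ (trans (lookup∘tabulate f x) (to T-≡ fx))

  ∈-tabulate⁻ : x ∈ tabulate f → T (f x)
  ∈-tabulate⁻ x∈ = from T-≡ (trans (sym (lookup∘tabulate f x)) ([]=⇒lookup x∈))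

tabulate-⊆ : ∀ {n} {f g : Fin n → Bool} → (∀ i → T (f i) → T (g i)) → tabulate f ⊆ tabulate g
tabulate-⊆ f⇒g = ∈-tabulate⁺ ∘ f⇒g _ ∘ ∈-tabulate⁻

∣tabulate∣≡count : ∀ n (f : ℕ → Bool) → ∣ tabulate {n = n} (f ∘ toℕ) ∣ ≡ count n f
∣tabulate∣≡count zero    f = refl
∣tabulate∣≡count (suc n) f with f 0
... | true  = cong suc (∣tabulate∣≡count n (f ∘ suc))
... | false = ∣tabulate∣≡count n (f ∘ suc)

x∈p⇒∣p∣>0 : ∀ {n} {p : Subset n} {x} → x ∈ p → 0 < ∣ p ∣
x∈p⇒∣p∣>0 {p = p} {x} x∈p = subst (_≤ ∣ p ∣) (∣⁅x⁆∣≡1 x)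
  (p⊆q⇒∣p∣≤∣q∣ (λ y∈⁅x⁆ → subst (_∈ p) (sym (x∈⁅y⁆⇒x≡y x y∈⁅x⁆)) x∈p))

∣p∣>0⇒Nonempty : ∀ {n} {p : Subset n} → 0 < ∣ p ∣ → Nonempty p
∣p∣>0⇒Nonempty {n} {p} ∣p∣>0 with nonempty? p
... | yes ne = ne
... | no ¬ne = contradiction (trans (cong ∣_∣ (Empty-unique ¬ne)) (∣⊥∣≡0 n)) (≢-sym (<⇒≢ ∣p∣>0))

∣p∣<n⇒∃∉ : ∀ {n} {p : Subset n} → ∣ p ∣ < n → ∃ λ x → x ∉ p
∣p∣<n⇒∃∉ {p = p} ∣p∣<n =
  let x , x∈∁p = ∣p∣>0⇒Nonempty (subst (0 <_) (sym (∣∁p∣≡n∸∣p∣ p)) (m<n⇒0<n∸m ∣p∣<n))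
  in x , x∈∁p⇒x∉p x∈∁p

T-does⇒ : ∀ {A : Set} (a? : Dec A) → T (does a?) → A
T-does⇒ (yes a) _ = a

module _ {n : ℕ} {v : Vector n} where

  ∈-supp⁺ : ∀ {j} → 0ℚ ℚ.< v j → j ∈ supp v
  ∈-supp⁺ v>0 = ∈-tabulate⁺ (from T-≡ (dec-true (0ℚ ℚ.<? _) v>0))

  ∈-supp⁻ : ∀ {j} → j ∈ supp v → 0ℚ ℚ.< v j
  ∈-supp⁻ j∈ = T-does⇒ (0ℚ ℚ.<? _) (∈-tabulate⁻ j∈)

  weight>0⇒∃pos : 0 < weight v → ∃ λ j → 0ℚ ℚ.< v j
  weight>0⇒∃pos w>0 = let j , j∈ = ∣p∣>0⇒Nonempty w>0 in j , ∈-supp⁻ j∈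

notContained>0 : ∀ {n} (A : Matrix n) c → (∀ i → ∃ λ j → 0ℚ ℚ.< A i j) → weight (col A c) < n →
                 0 < notContained A c
notContained>0 A c rowsNZ w<n = x∈p⇒∣p∣>0 (∈-tabulate⁺ {x = j} (from T-not-≡ (dec-false (_ ⊆? _) ⊈)))
  where
  r = proj₁ (∣p∣<n⇒∃∉ w<n)
  j = proj₁ (rowsNZ r)
  ⊈ : ¬ (supp (col A j) ⊆ supp (col A c))
  ⊈ sub = proj₂ (∣p∣<n⇒∃∉ w<n) (sub (∈-supp⁺ {v = col A j} (proj₂ (rowsNZ r))))

indicator : ∀ n → (ℕ → ℕ → Bool) → Matrix n
indicator n B i j = if B (toℕ i) (toℕ j) then 1ℚ else 0ℚ

module _ {n : ℕ} (B : ℕ → ℕ → Bool) where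

  private
    A = indicator n B

    0<?-indicator : ∀ b → does (0ℚ ℚ.<? (if b then 1ℚ else 0ℚ)) ≡ b
    0<?-indicator true  = refl
    0<?-indicator false = refl

  supp-indicator-col : ∀ j → supp (col A j) ≡ tabulate (λ r → B (toℕ r) (toℕ j))
  supp-indicator-col j = tabulate-cong (λ r → 0<?-indicator (B (toℕ r) (toℕ j)))

  weight-indicator-col : ∀ j → weight (col A j) ≡ count n (λ r → B r (toℕ j))
  weight-indicator-col j =
    trans (cong (∣_∣ {n}) (supp-indicator-col j)) (∣tabulate∣≡count n (λ r → B r (toℕ j)))

  weight-indicator-row : ∀ i → weight (row A i) ≡ count n (B (toℕ i))
  weight-indicator-row i =
    trans (cong (∣_∣ {n}) (tabulate-cong (λ j → 0<?-indicator (B (toℕ i) (toℕ j)))))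
          (∣tabulate∣≡count n (B (toℕ i)))

  indicator-InS : ∀ {k} → (∀ r → r < n → 0 < count n (B r) × count n (B r) ≤ k) →
                  (∀ j → j < n → 0 < count n (λ r → B r j) × count n (λ r → B r j) ≤ k) →
                  ∀ c → InC n k A c → InS n k A
  indicator-InS {k} rows cols c c∈C =
    nonneg , (nzRow , nzCol) , rowWeight , colWeight , (c , c∈C)
    where
    nonneg : Nonnegative A
    nonneg i j with B (toℕ i) (toℕ j)
    ... | true  = ℚ.<⇒≤ (ℚ.positive⁻¹ 1ℚ)
    ... | false = ℚ.≤-refl
    nzRow : ∀ i → ∃ λ j → 0ℚ ℚ.< A i j
    nzRow i = weight>0⇒∃pos (subst (0 <_) (sym (weight-indicator-row i)) (proj₁ (rows _ (toℕ<n i))))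
    nzCol : ∀ j → ∃ λ i → 0ℚ ℚ.< A i j
    nzCol j = weight>0⇒∃pos (subst (0 <_) (sym (weight-indicator-col j)) (proj₁ (cols _ (toℕ<n j))))
    rowWeight : ∀ i → weight (row A i) ≤ k
    rowWeight i = subst (_≤ k) (sym (weight-indicator-row i)) (proj₂ (rows _ (toℕ<n i)))
    colWeight : ∀ j → weight (col A j) ≤ k
    colWeight j = subst (_≤ k) (sym (weight-indicator-col j)) (proj₂ (cols _ (toℕ<n j)))

  notContained-indicator : ∀ {a} c → a ≤ n → (∀ j → j < a → ∀ r → T (B r j) → T (B r (toℕ c))) →
                           notContained A c ≤ n ∸ a
  notContained-indicator {a} c a≤n below = begin
    notContained A c                        ≤⟨ p⊆q⇒∣p∣≤∣q∣ (tabulate-⊆ beyond) ⟩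
    ∣ tabulate {n = n} (λ j → a ≤ᵇ toℕ j) ∣ ≡⟨ ∣tabulate∣≡count n (a ≤ᵇ_) ⟩
    count n (a ≤ᵇ_)                         ≡⟨ count-≤ᵇ a≤n ⟩
    n ∸ a                                   ∎
    where
    open ≤-Reasoning
    beyond : ∀ j → T (not (does (supp (col A j) ⊆? supp (col A c)))) → T (a ≤ᵇ toℕ j)
    beyond j ⊈ with toℕ j <? a
    ... | no  j≮a = ≤⇒≤ᵇ (≮⇒≥ j≮a)
    ... | yes j<a = contradiction (trans (sym (dec-true (_ ⊆? _) ⊆c)) (to T-not-≡ ⊈)) λ ()
      where
      ⊆c : supp (col A j) ⊆ supp (col A c)
      ⊆c = subst₂ _⊆_ (sym (supp-indicator-col j)) (sym (supp-indicator-col c))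
                  (tabulate-⊆ (λ r → below (toℕ j) j<a (toℕ r)))

ceilDiv≤ : ∀ a k → ceilDiv a k ≤ a
ceilDiv≤ a zero    = z≤n
ceilDiv≤ a (suc K) = s≤s⁻¹ (m<n*o⇒m/o<n (begin-strict
  a + K             ≡⟨ +-comm a K ⟩
  K + a             <⟨ +-monoˡ-< a (n<1+n K) ⟩
  suc K + a         ≤⟨ +-monoʳ-≤ (suc K) (m≤m*n a (suc K)) ⟩
  suc a * suc K     ∎))
  where open ≤-Reasoning

ceilDiv>0 : ∀ {a} k .{{_ : NonZero k}} → 0 < a → 0 < ceilDiv a k
ceilDiv>0 (suc K) 0<a = m≥n⇒m/n>0 (+-monoˡ-≤ K 0<a)

≤*ceilDiv : ∀ a k .{{_ : NonZero k}} → a ≤ k * ceilDiv a k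
≤*ceilDiv a k@(suc K) = subst (a ≤_) (*-comm q k) (+-cancelʳ-≤ K a (q * k) (begin
  a + K                     ≡⟨ m≡m%n+[m/n]*n (a + K) k ⟩
  (a + K) % k + q * k       ≤⟨ +-monoˡ-≤ (q * k) (s≤s⁻¹ (m%n<n (a + K) k)) ⟩
  K + q * k                 ≡⟨ +-comm K (q * k) ⟩
  q * k + K                 ∎))
  where
  open ≤-Reasoning
  q = ceilDiv a k

[+m]-[+n]-1≡m⊖1+n : ∀ m n → + m ℤ.- + n ℤ.- + 1 ≡ m ⊖ suc n
[+m]-[+n]-1≡m⊖1+n m n = begin
  + m ℤ.- + n ℤ.- + 1           ≡⟨ ℤ.+-assoc (+ m) (ℤ.- + n) (ℤ.- + 1) ⟩
  + m ℤ.+ (ℤ.- + n ℤ.- + 1)     ≡⟨ cong (λ i → + m ℤ.+ i) (ℤ.neg-distrib-+ (+ n) (+ 1)) ⟨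
  + m ℤ.- + (n + 1)             ≡⟨ cong (λ i → + m ℤ.- + i) (+-comm n 1) ⟩
  + m ℤ.- + suc n               ≡⟨ ℤ.[+m]-[+n]≡m⊖n m (suc n) ⟩
  m ⊖ suc n                     ∎
  where open ≡-Reasoning

+≤⊖⇒≤ : ∀ {q} m n → + q ℤ.≤ m ⊖ n → n ≤ m
+≤⊖⇒≤ {q} m n q≤m⊖n with n ≤? m
... | yes n≤m = n≤m
... | no  n≰m = contradiction (ℤ.≤-<-trans q≤m⊖n m⊖n<0) ℤ.+≮0
  where m⊖n<0 = subst (m ⊖ n ℤ.<_) (ℤ.n⊖n≡0 n) (ℤ.⊖-monoˡ-< n (≰⇒> n≰m))

q≤m⊖n⇒m⊖n≡q⊔[m∸n] : ∀ {q} m n → + q ℤ.≤ m ⊖ n → m ⊖ n ≡ + (q ⊔ (m ∸ n))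
q≤m⊖n⇒m⊖n≡q⊔[m∸n] {q} m n q≤m⊖n =
  trans m⊖n≡m∸n (cong +_ (sym (m≤n⇒m⊔n≡n (ℤ.drop‿+≤+ (subst (+ q ℤ.≤_) m⊖n≡m∸n q≤m⊖n)))))
  where m⊖n≡m∸n = ℤ.⊖-≥ (+≤⊖⇒≤ m n q≤m⊖n)

q≰m⊖n⇒q≡q⊔[m∸n] : ∀ {q} m n → ¬ (+ q ℤ.≤ m ⊖ n) → q ≡ q ⊔ (m ∸ n)
q≰m⊖n⇒q≡q⊔[m∸n] {q} m n q≰m⊖n = sym (m≥n⇒m⊔n≡m m∸n≤q)
  where
  m∸n≤q : m ∸ n ≤ q
  m∸n≤q with n ≤? m
  ... | yes n≤m = <⇒≤ (≰⇒> (q≰m⊖n ∘ subst (+ q ℤ.≤_) (sym (ℤ.⊖-≥ n≤m)) ∘ ℤ.+≤+))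
  ... | no  n≰m = subst (_≤ q) (sym (m≤n⇒m∸n≡0 (<⇒≤ (≰⇒> n≰m)))) z≤n

u≡ : ∀ n k → u n k ≡ + (ceilDiv (n ∸ k) k ⊔ (n ∸ suc (k * (k ∸ 1))))
u≡ n k with ℤ.+ (ceilDiv (n ∸ k) k) ℤ.≤? (+ n ℤ.- + (k * (k ∸ 1)) ℤ.- + 1)
... | yes q≤X = trans X≡ (q≤m⊖n⇒m⊖n≡q⊔[m∸n] n (suc a) (subst (+ q ℤ.≤_) X≡ q≤X))
  where
  q = ceilDiv (n ∸ k) k
  a = k * (k ∸ 1)
  X≡ = [+m]-[+n]-1≡m⊖1+n n a
... | no  q≰X =
  cong +_ (q≰m⊖n⇒q≡q⊔[m∸n] n (suc a) (q≰X ∘ subst (+ q ℤ.≤_) (sym ([+m]-[+n]-1≡m⊖1+n n a))))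
  where
  q = ceilDiv (n ∸ k) k
  a = k * (k ∸ 1)

-- Witnesses of a_k^n ≤ b.
a≤ : ℕ → ℕ → ℕ → Set
a≤ n k b = Σ (Matrix n) λ A → InS n k A × Σ (Fin n) λ c → InC n k A c × notContained A c ≤ b

module RoundRobin (k p m : ℕ) .{{_ : NonZero k}} .{{_ : NonZero m}} (k≤1+p : k ≤ suc p)
                  (p≤k[k∸1] : p ≤ k * (k ∸ 1)) (n∸k≤k*m : suc (p + m) ∸ k ≤ k * m) where

  n = suc (p + m)

  edge : ℕ → ℕ → Bool
  edge r zero    = r <ᵇ k
  edge r (suc j) = if j <ᵇ p then r ≡ᵇ j % k else ((k ≤ᵇ r) ∧ (j ∸ p ≡ᵇ (r ∸ k) % m))

  k≤n : k ≤ n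
  k≤n = ≤-trans k≤1+p (s≤s (m≤m+n p m))

  m≤n∸k : m ≤ n ∸ k
  m≤n∸k = m+n≤o⇒m≤o∸n m (subst (_≤ n) (+-comm k m) (+-monoˡ-≤ m k≤1+p))

  edge-head : ∀ {r j} → j < p → edge r (suc j) ≡ (r ≡ᵇ j % k)
  edge-head j<p rewrite to T-≡ (<⇒<ᵇ j<p) = refl

  edge-tail : ∀ {r j} → p ≤ j → edge r (suc j) ≡ ((k ≤ᵇ r) ∧ (j ∸ p ≡ᵇ (r ∸ k) % m))
  edge-tail {j = j} p≤j rewrite ¬T⇒≡false (≤⇒≯ p≤j ∘ <ᵇ⇒< j p) = refl

  count-top-row : ∀ {r} → r < k → count n (edge r) ≡ suc (count p (λ j → r ≡ᵇ j % k))
  count-top-row {r} r<k = begin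
    count n (edge r)
      ≡⟨ count-suc-true (p + m) (edge r) (<⇒<ᵇ r<k) ⟩
    suc (count (p + m) (edge r ∘ suc))
      ≡⟨ cong suc (count-+ p m (edge r ∘ suc)) ⟩
    suc (count p (edge r ∘ suc) + count m (λ t → edge r (suc (p + t))))
      ≡⟨ cong suc (cong₂ _+_ (count-cong p (λ j j<p → edge-head j<p)) (count-none m tail-empty)) ⟩
    suc (count p (λ j → r ≡ᵇ j % k) + 0)
      ≡⟨ cong suc (+-identityʳ _) ⟩
    suc (count p (λ j → r ≡ᵇ j % k))
      ∎
    where
    open ≡-Reasoning
    tail-empty : ∀ t → t < m → ¬ T (edge r (suc (p + t)))
    tail-empty t _ hit rewrite edge-tail {r} (m≤m+n p t) = <⇒≱ r<k (≤ᵇ⇒≤ k r (proj₁ (to T-∧ hit)))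

  count-bottom-row : ∀ {r} → k ≤ r → count n (edge r) ≡ count m (λ t → t ≡ᵇ (r ∸ k) % m)
  count-bottom-row {r} k≤r = begin
    count n (edge r)
      ≡⟨ count-suc-false (p + m) (edge r) (λ r<k → <⇒≱ (<ᵇ⇒< r k r<k) k≤r) ⟩
    count (p + m) (edge r ∘ suc)
      ≡⟨ count-+ p m (edge r ∘ suc) ⟩
    count p (edge r ∘ suc) + count m (λ t → edge r (suc (p + t)))
      ≡⟨ cong₂ _+_ (count-none p head-empty) (count-cong m tail-hit) ⟩
    count m (λ t → t ≡ᵇ (r ∸ k) % m)
      ∎
    where
    open ≡-Reasoning
    head-empty : ∀ j → j < p → ¬ T (edge r (suc j))
    head-empty j j<p hit rewrite edge-head {r} j<p =
      <⇒≱ (subst (_< k) (sym (≡ᵇ⇒≡ r _ hit)) (m%n<n j k)) k≤r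
    tail-hit : ∀ t → t < m → edge r (suc (p + t)) ≡ (t ≡ᵇ (r ∸ k) % m)
    tail-hit t _ = trans (edge-tail (m≤m+n p t))
                         (cong₂ (λ b i → b ∧ (i ≡ᵇ (r ∸ k) % m)) (to T-≡ (≤⇒≤ᵇ k≤r)) (m+n∸m≡n p t))

  count-head-col : ∀ {j} → j < p → count n (λ r → edge r (suc j)) ≡ 1
  count-head-col {j} j<p =
    trans (count-cong n (λ r _ → edge-head {r} j<p)) (count-≡ᵇ {n} {j % k} (<-≤-trans (m%n<n j k) k≤n))

  count-tail-col : ∀ {j} → p ≤ j → count n (λ r → edge r (suc j)) ≡ count (n ∸ k) (λ i → j ∸ p ≡ᵇ i % m)
  count-tail-col {j} p≤j = begin
    count n (λ r → edge r (suc j))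
      ≡⟨ count-split (λ r → edge r (suc j)) k≤n ⟩
    count k (λ r → edge r (suc j)) + count (n ∸ k) (λ i → edge (k + i) (suc j))
      ≡⟨ cong₂ _+_ (count-none k top-empty) (count-cong (n ∸ k) bottom-hit) ⟩
    count (n ∸ k) (λ i → j ∸ p ≡ᵇ i % m)
      ∎
    where
    open ≡-Reasoning
    top-empty : ∀ r → r < k → ¬ T (edge r (suc j))
    top-empty r r<k hit rewrite edge-tail {r} p≤j = <⇒≱ r<k (≤ᵇ⇒≤ k r (proj₁ (to T-∧ hit)))
    bottom-hit : ∀ i → i < n ∸ k → edge (k + i) (suc j) ≡ (j ∸ p ≡ᵇ i % m)
    bottom-hit i _ = trans (edge-tail p≤j)
      (cong₂ (λ b l → b ∧ (j ∸ p ≡ᵇ l % m)) (to T-≡ (≤⇒≤ᵇ (m≤m+n k i))) (m+n∸m≡n k i))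

  row-bounds : ∀ r → r < n → 0 < count n (edge r) × count n (edge r) ≤ k
  row-bounds r _ with r <? k
  ... | yes r<k rewrite count-top-row r<k =
    s≤s z≤n ,
    subst (suc (count p (λ j → r ≡ᵇ j % k)) ≤_) (suc-pred k) (s≤s (count-%-fiber (k ∸ 1) k r p≤[k∸1]*k))
    where p≤[k∸1]*k = subst (p ≤_) (*-comm k (k ∸ 1)) p≤k[k∸1]
  ... | no  r≮k rewrite count-bottom-row (≮⇒≥ r≮k) | count-≡ᵇ {m} (m%n<n (r ∸ k) m) =
    s≤s z≤n , >-nonZero⁻¹ k

  col-bounds : ∀ j → j < n → 0 < count n (λ r → edge r j) × count n (λ r → edge r j) ≤ k
  col-bounds zero _ rewrite count-<ᵇ k≤n = >-nonZero⁻¹ k , ≤-refl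
  col-bounds (suc j) (s<s j<p+m) with j <? p
  ... | yes j<p rewrite count-head-col j<p = s≤s z≤n , >-nonZero⁻¹ k
  ... | no  j≮p rewrite count-tail-col (≮⇒≥ j≮p) =
    count>0 (≤-trans t<m m≤n∸k) (≡⇒≡ᵇ _ _ (sym (m<n⇒m%n≡m t<m))) , count-%-fiber k m (j ∸ p) n∸k≤k*m
    where t<m = m<n+o⇒m∸n<o j p j<p+m

  head-cols-⊆-col₀ : ∀ j → j < suc p → ∀ r → T (edge r j) → T (edge r 0)
  head-cols-⊆-col₀ zero    _         r hit = hit
  head-cols-⊆-col₀ (suc j) (s≤s j<p) r hit rewrite edge-head {r} j<p =
    <⇒<ᵇ (subst (_< k) (sym (≡ᵇ⇒≡ r _ hit)) (m%n<n j k))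

  a≤m : a≤ n k m
  a≤m =
    A , indicator-InS edge row-bounds col-bounds Fin.zero col₀∈C , Fin.zero , col₀∈C , notContained≤m
    where
    A = indicator n edge
    col₀∈C : InC n k A Fin.zero
    col₀∈C = trans (weight-indicator-col {n} edge Fin.zero) (count-<ᵇ {k} {n} k≤n)
    notContained≤m : notContained A Fin.zero ≤ m
    notContained≤m = subst (notContained A Fin.zero ≤_) (m+n∸m≡n p m)
                           (notContained-indicator edge Fin.zero (s≤s (m≤m+n p m)) head-cols-⊆-col₀)

a-upper-bound : ∀ n k .{{_ : NonZero k}} → k < n → a≤ n k (ceilDiv (n ∸ k) k ⊔ (n ∸ suc (k * (k ∸ 1))))
a-upper-bound (suc n′) k@(suc K) k<n =
  subst (λ n → a≤ (suc n) k m) (m∸n+n≡m m≤n′) (RoundRobin.a≤m k (n′ ∸ m) m k≤1+p p≤k[k∸1] n∸k≤k*m′)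
  where
  n = suc n′
  q = ceilDiv (n ∸ k) k
  a = k * (k ∸ 1)
  m = q ⊔ (n′ ∸ a)
  instance
    m-nonZero : NonZero m
    m-nonZero = >-nonZero (<-≤-trans (ceilDiv>0 k (m<n⇒0<n∸m k<n)) (m≤m⊔n q _))
  m≤n∸k : m ≤ n ∸ k
  m≤n∸k = ⊔-lub (ceilDiv≤ (n ∸ k) k) (∸-monoʳ-≤ n (s≤s (m≤m+n K (K * K))))
  m≤n′ : m ≤ n′
  m≤n′ = ≤-trans m≤n∸k (m∸n≤m n′ K)
  k≤1+p : k ≤ suc (n′ ∸ m)
  k≤1+p = s≤s (m+n≤o⇒m≤o∸n K (subst (_≤ n′) (+-comm m K) (m≤o∸n⇒m+n≤o m (<⇒≤ (s≤s⁻¹ k<n)) m≤n∸k)))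
  p≤k[k∸1] : n′ ∸ m ≤ a
  p≤k[k∸1] = m≤n+o⇒m∸n≤o n′ m
    (≤-trans (m≤n+m∸n n′ a) (subst (a + (n′ ∸ a) ≤_) (+-comm a m) (+-monoʳ-≤ a (m≤n⊔m q _))))
  n∸k≤k*m : n ∸ k ≤ k * m
  n∸k≤k*m = ≤-trans (≤*ceilDiv (n ∸ k) k) (*-monoʳ-≤ k (m≤m⊔n q _))
  n∸k≤k*m′ : suc (n′ ∸ m + m) ∸ k ≤ k * m
  n∸k≤k*m′ = subst (λ x → suc x ∸ k ≤ k * m) (sym (m∸n+n≡m m≤n′)) n∸k≤k*m

lemma3p6 : (n k : ℕ) → 2 ≤ n → 2 ≤ k → k ≤ n ∸ 1 →
    ((A : Matrix n) → InS n k A → (c : _) → InC n k A c → 1 ≤ notContained A c)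
    × Σ (Matrix n) (λ A → InS n k A × Σ _ (λ c → InC n k A c × (+ notContained A c) ℤ.≤ u n k))
lemma3p6 n k 2≤n 2≤k k≤n∸1 = lower , upper
  where
  instance
    n-nonZero : NonZero n
    n-nonZero = >-nonZero (≤-trans (s≤s z≤n) 2≤n)
    k-nonZero : NonZero k
    k-nonZero = >-nonZero (≤-trans (s≤s z≤n) 2≤k)
  k<n : k < n
  k<n = m≤pred[n]⇒suc[m]≤n k≤n∸1
  lower : (A : Matrix n) → InS n k A → (c : Fin n) → InC n k A c → 1 ≤ notContained A c
  lower A (_ , (rowsNZ , _) , _) c c∈C = notContained>0 A c rowsNZ (subst (_< n) (sym c∈C) k<n)
  upper : Σ (Matrix n) λ A → InS n k A × Σ (Fin n) λ c → InC n k A c × + notContained A c ℤ.≤ u n k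
  upper = let A , A∈S , c , c∈C , bound = a-upper-bound n k k<n
          in A , A∈S , c , c∈C , subst (+ notContained A c ℤ.≤_) (sym (u≡ n k)) (ℤ.+≤+ bound)
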